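{- Let $A$ be a finite set with $|A|\ge3$ and let $a_1,a_2\in A$ be distinct. Suppose $\mathcal V_i$ is a regular vine on $A\setminus\{a_i\}$ for $i\in\{1,2\}$ and $\mathcal V'$ is a regular vine on $A\setminus\{a_1,a_2\}$ with $\mathcal V'\subseteq\mathcal V_1\cap\mathcal V_2$. Then $\mathcal V'=\mathcal V_1\cap\mathcal V_2$.
   Context: A regular vine on an $m$-element set $X$ is an induced subposet $\mathcal V$ of $(2^X,\subseteq)$ such that (1) all maximal chains have length $m-1$ and minimal elements have rank 1 (so $\mathcal V$ is graded); (2) $\mathcal V$ has exactly $m$ minimal elements (hence these are the singletons $\{x\}$, $x\in X$, and the maximum is $X$); rank equals cardinality, and $\mathcal V(i)$ denotes the elements of rank $i$; (3) every non-minimal element covers exactly two elements; (4) for $1\le i\le m-1$, the graph on $\mathcal V(i)$ whose edges are the elements of $\mathcal V(i+1)$, each joining the two elements it covers, is a tree; (5) if two elements of $\mathcal V(i)$, $i\ge2$, are covered by a common element, then they cover a common element. -}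

module Defs where

open import Data.Nat using (ℕ; _≤_; _+_; _∸_)
open import Data.Bool using (Bool; true)
open import Data.Fin using (Fin)
open import Data.Fin.Subset using (Subset; _⊆_; _⊂_; ⁅_⁆; ∣_∣; _∈_)
open import Data.List using (List; []; _∷_; _++_; length)
open import Data.List.Relation.Unary.Linked using (Linked)
open import Data.List.Relation.Unary.Unique.Propositional using (Unique)
open import Data.Product using (Σ; ∃; ∃-syntax; _×_)
open import Data.Sum using (_⊎_)
open import Relation.Nullary using (¬_)
open import Relation.Binary.PropositionalEquality using (_≡_; _≢_)

-- Generic simple graphs: a carrier C, a vertex predicate and an
-- adjacency relation (assumed to relate vertices only).

module _ {C : Set} (Vert : C → Set) (Adj : C → C → Set) where

  data Walk : C → C → Set where
    here : ∀ {u} → Walk u u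
    step : ∀ {u v w} → Adj u v → Walk v w → Walk u w

  Connected : Set
  Connected = ∀ u v → Vert u → Vert v → Walk u v

  -- a cycle v₀ - v₁ - ... - vₖ - v₀ with k ≥ 2 (length ≥ 3) and the
  -- vertices v₀,…,vₖ pairwise distinct
  HasCycle : Set
  HasCycle = ∃[ v₀ ] ∃[ vs ]
    (2 ≤ length vs × Unique (v₀ ∷ vs) × Linked Adj (v₀ ∷ vs ++ v₀ ∷ []))

  IsTree : Set
  IsTree = (∃[ v ] Vert v) × Connected × ¬ HasCycle

-- Families of subsets of Fin n (finite subposets of (2^[n], ⊆)),
-- given by their (decidable) characteristic function.

Family : ℕ → Set
Family n = Subset n → Bool

module _ {n : ℕ} where

  Mem : Family n → Subset n → Set
  Mem 𝒱 S = 𝒱 S ≡ true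

  Covers : Family n → Subset n → Subset n → Set
  Covers 𝒱 S T = Mem 𝒱 T × Mem 𝒱 S × T ⊂ S ×
    (∀ U → Mem 𝒱 U → T ⊆ U → U ⊆ S → U ≡ T ⊎ U ≡ S)

  Minimal : Family n → Subset n → Set
  Minimal 𝒱 S = Mem 𝒱 S × (∀ T → Mem 𝒱 T → T ⊆ S → T ≡ S)

  Rank : Family n → ℕ → Subset n → Set
  Rank 𝒱 i S = Mem 𝒱 S × ∣ S ∣ ≡ i

  -- graph on 𝒱(i) whose edges are the elements of 𝒱(i+1), each joining
  -- the two elements it covers
  LevelAdj : Family n → ℕ → Subset n → Subset n → Set
  LevelAdj 𝒱 i T₁ T₂ = Rank 𝒱 i T₁ × Rank 𝒱 i T₂ × T₁ ≢ T₂ ×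
    ∃[ S ] (Rank 𝒱 (i + 1) S × Covers 𝒱 S T₁ × Covers 𝒱 S T₂)

  record RegularVine (X : Subset n) (𝒱 : Family n) : Set where
    field
      sub       : ∀ S → Mem 𝒱 S → S ⊆ X
      top       : Mem 𝒱 X
      graded    : ∀ S T → Covers 𝒱 S T → ∣ T ∣ + 1 ≡ ∣ S ∣
      singleton : ∀ x → x ∈ X → Mem 𝒱 ⁅ x ⁆
      minimal   : ∀ S → Minimal 𝒱 S → ∃[ x ] (x ∈ X × S ≡ ⁅ x ⁆)
      twoCovers : ∀ S → Mem 𝒱 S → ¬ Minimal 𝒱 S →
        ∃[ T₁ ] ∃[ T₂ ] (T₁ ≢ T₂ × Covers 𝒱 S T₁ × Covers 𝒱 S T₂ ×
          (∀ T → Covers 𝒱 S T → T ≡ T₁ ⊎ T ≡ T₂))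
      tree      : ∀ i → 1 ≤ i → i ≤ ∣ X ∣ ∸ 1 →
        IsTree (Rank 𝒱 i) (LevelAdj 𝒱 i)
      proximity : ∀ i → 2 ≤ i → ∀ T₁ T₂ → Rank 𝒱 i T₁ → Rank 𝒱 i T₂ →
        (∃[ S ] (Covers 𝒱 S T₁ × Covers 𝒱 S T₂)) →
        ∃[ U ] (Covers 𝒱 T₁ U × Covers 𝒱 T₂ U)

{-# OPTIONS --safe #-}
-- If regular vines satisfy 𝒱′ ⊆ 𝒱 and 𝒱′ lives on X′, then every S ∈ 𝒱 with S ⊆ X′ lies in 𝒱′;
-- the theorem is this for 𝒱 = 𝒱₁, with 𝒱₂ serving only to show a₂ ∉ S. Induct on ∣S∣: a non-singleton S covers two distinct T₁, T₂ ∈ 𝒱, which lie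
-- in 𝒱′ by induction. The tree of 𝒱′ at their level joins them by a path whose edges are edges
-- of 𝒱. Since S = T₁ ∪ T₂ is the only possible edge between T₁ and T₂, if S ∉ 𝒱′ this path and
-- the edge S form a cycle in the tree of 𝒱; membership being decidable, S ∈ 𝒱′ follows.
module Submission where

open import Defs
open import Data.Bool using (true) renaming (_≟_ to _≟ᵇ_)
open import Data.Fin using (Fin)
open import Data.Fin.Subset using (Subset; ⊤; _-_; _─_; _⊆_; _∈_; _∉_; ∣_∣; _∪_; inside; outside)
open import Data.Fin.Subset.Properties
  using (p⊆q⇒∣p∣≤∣q∣; p⊂q⇒p⊆q; x∈⁅x⁆; x∉⁅y⁆⇒x≢y; ∣⁅x⁆∣≡1; x∈p∧x≢y⇒x∈p-y; p⊆p∪q; q⊆p∪q; x∈p∪q⁻; drop-∷-⊆)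
open import Data.List using (List; []; _∷_; _++_)
open import Data.List.Relation.Unary.Any using (Any; here; there; any?)
open import Data.List.Relation.Unary.All using ([])
open import Data.List.Relation.Unary.All.Properties.Core using (¬Any⇒All¬)
open import Data.List.Relation.Unary.AllPairs using ([]; _∷_)
open import Data.List.Relation.Unary.Linked using (Linked; [-]; _∷_)
open import Data.List.Relation.Unary.Unique.Propositional using (Unique)
open import Data.Nat using (ℕ; zero; suc; _+_; _∸_; _≤_; s≤s; z≤n; _≟_)
open import Data.Nat.Properties using (≤-antisym; ≤∧≢⇒<; <-irrefl; +-comm; suc-injective; ∸-monoˡ-≤; n≢0⇒n>0)
open import Data.Product using (_×_; _,_; proj₁; proj₂; ∃-syntax)
open import Data.Sum using (_⊎_; inj₁; inj₂; [_,_])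
open import Data.Vec using ([]; _∷_; here; there)
open import Data.Vec.Properties using (≡-dec)
open import Function using (_∘_)
open import Function.Bundles using (_⇔_; mk⇔)
open import Relation.Binary.Definitions using (DecidableEquality)
open import Relation.Binary.PropositionalEquality using (_≡_; _≢_; refl; sym; trans; cong; subst)
open import Relation.Nullary using (¬_; yes; no; contradiction)
open import Relation.Nullary.Decidable using (decidable-stable)

p⊆q∧∣p∣≡∣q∣⇒p≡q : ∀ {n} {p q : Subset n} → p ⊆ q → ∣ p ∣ ≡ ∣ q ∣ → p ≡ q
p⊆q∧∣p∣≡∣q∣⇒p≡q {p = []}          {[]}          _   _ = refl
p⊆q∧∣p∣≡∣q∣⇒p≡q {p = outside ∷ p} {outside ∷ q} p⊆q e =
  cong (outside ∷_) (p⊆q∧∣p∣≡∣q∣⇒p≡q (drop-∷-⊆ p⊆q) e)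
p⊆q∧∣p∣≡∣q∣⇒p≡q {p = inside ∷ p}  {inside ∷ q}  p⊆q e =
  cong (inside ∷_) (p⊆q∧∣p∣≡∣q∣⇒p≡q (drop-∷-⊆ p⊆q) (suc-injective e))
p⊆q∧∣p∣≡∣q∣⇒p≡q {p = inside ∷ p}  {outside ∷ q} p⊆q _ with p⊆q here
... | ()
p⊆q∧∣p∣≡∣q∣⇒p≡q {p = outside ∷ p} {inside ∷ q}  p⊆q e =
  contradiction (subst (_≤ ∣ q ∣) e (p⊆q⇒∣p∣≤∣q∣ (drop-∷-⊆ p⊆q))) (<-irrefl refl)

x∈p─q⇒x∉q : ∀ {n} {p q : Subset n} {x} → x ∈ p ─ q → x ∉ q
x∈p─q⇒x∉q {p = inside ∷ _} {outside ∷ _} here ()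
x∈p─q⇒x∉q {p = _ ∷ _}      {_ ∷ _}       (there x∈p─q) (there x∈q) = x∈p─q⇒x∉q x∈p─q x∈q

x∈p-y⇒x≢y : ∀ {n} {p : Subset n} {x y} → x ∈ p - y → x ≢ y
x∈p-y⇒x≢y = x∉⁅y⁆⇒x≢y ∘ x∈p─q⇒x∉q

∣p∣≡1+j∧p⊆q⇒j≤∣q∣∸1 : ∀ {n} {p q : Subset n} {j} → ∣ p ∣ ≡ suc j → p ⊆ q → j ≤ ∣ q ∣ ∸ 1
∣p∣≡1+j∧p⊆q⇒j≤∣q∣∸1 {q = q} ∣p∣≡1+j p⊆q = ∸-monoˡ-≤ 1 (subst (_≤ ∣ q ∣) ∣p∣≡1+j (p⊆q⇒∣p∣≤∣q∣ p⊆q))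

p⊆r∧q⊆r⇒p∪q⊆r : ∀ {n} {p q r : Subset n} → p ⊆ r → q ⊆ r → p ∪ q ⊆ r
p⊆r∧q⊆r⇒p∪q⊆r {p = p} {q} p⊆r q⊆r x∈p∪q = [ p⊆r , q⊆r ] (x∈p∪q⁻ p q x∈p∪q)

between-consecutive : ∀ {n} {T U S : Subset n} →
  T ⊆ U → U ⊆ S → ∣ T ∣ + 1 ≡ ∣ S ∣ → U ≡ T ⊎ U ≡ S
between-consecutive {T = T} {U} {S} T⊆U U⊆S ∣T∣+1≡∣S∣ with ∣ U ∣ ≟ ∣ T ∣
... | yes ∣U∣≡∣T∣ = inj₁ (sym (p⊆q∧∣p∣≡∣q∣⇒p≡q T⊆U (sym ∣U∣≡∣T∣)))
... | no ∣U∣≢∣T∣ = inj₂ (p⊆q∧∣p∣≡∣q∣⇒p≡q U⊆S (≤-antisym (p⊆q⇒∣p∣≤∣q∣ U⊆S) ∣S∣≤∣U∣))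
  where
  ∣S∣≤∣U∣ : ∣ S ∣ ≤ ∣ U ∣
  ∣S∣≤∣U∣ = subst (_≤ ∣ U ∣) (trans (+-comm 1 ∣ T ∣) ∣T∣+1≡∣S∣)
    (≤∧≢⇒< (p⊆q⇒∣p∣≤∣q∣ T⊆U) (∣U∣≢∣T∣ ∘ sym))

distinct-⊆-consecutive⇒∪≡ : ∀ {n} {T₁ T₂ R : Subset n} → T₁ ≢ T₂ → ∣ T₁ ∣ ≡ ∣ T₂ ∣ →
  ∣ T₁ ∣ + 1 ≡ ∣ R ∣ → T₁ ⊆ R → T₂ ⊆ R → T₁ ∪ T₂ ≡ R
distinct-⊆-consecutive⇒∪≡ {T₁ = T₁} {T₂} T₁≢T₂ ∣T₁∣≡∣T₂∣ ∣T₁∣+1≡∣R∣ T₁⊆R T₂⊆R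
  with between-consecutive (p⊆p∪q T₂) (p⊆r∧q⊆r⇒p∪q⊆r T₁⊆R T₂⊆R) ∣T₁∣+1≡∣R∣
... | inj₂ T₁∪T₂≡R = T₁∪T₂≡R
... | inj₁ T₁∪T₂≡T₁ = contradiction
  (sym (p⊆q∧∣p∣≡∣q∣⇒p≡q (subst (T₂ ⊆_) T₁∪T₂≡T₁ (q⊆p∪q T₁ T₂)) (sym ∣T₁∣≡∣T₂∣))) T₁≢T₂

module _ {C : Set} where

  data Path (E : C → C → Set) : C → C → List C → Set where
    []  : ∀ {u} → Path E u u []
    _∷_ : ∀ {u w v xs} → E u w → Path E w v xs → Path E u v (w ∷ xs)

  SimplePath : (C → C → Set) → C → C → Set
  SimplePath E u v = ∃[ xs ] (Path E u v xs × Unique (u ∷ xs))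

  mapWalk : ∀ {Vert : C → Set} {E E′ : C → C → Set} {u v} →
    (∀ {x y} → E x y → E′ x y) → Walk Vert E u v → Walk Vert E′ u v
  mapWalk f here          = here
  mapWalk f (step e walk) = step (f e) (mapWalk f walk)

  module _ (_≟_ : DecidableEquality C) {E : C → C → Set} where

    suffixFrom : ∀ {u w v xs} → Any (u ≡_) (w ∷ xs) → Path E w v xs → Unique (w ∷ xs) →
      SimplePath E u v
    suffixFrom (here refl)  path       uniq       = _ , path , uniq
    suffixFrom (there ())   []         _
    suffixFrom (there u∈xs) (_ ∷ path) (_ ∷ uniq) = suffixFrom u∈xs path uniq

    prepend : ∀ {u w v} → E u w → SimplePath E w v → SimplePath E u v
    prepend {u} {w} e (xs , path , uniq) with any? (u ≟_) (w ∷ xs)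
    ... | yes u∈w∷xs = suffixFrom u∈w∷xs path uniq
    ... | no  u∉w∷xs = w ∷ xs , e ∷ path , ¬Any⇒All¬ (w ∷ xs) u∉w∷xs ∷ uniq

    walk⇒simplePath : ∀ {Vert : C → Set} {u v} → Walk Vert E u v → SimplePath E u v
    walk⇒simplePath here          = [] , [] , [] ∷ []
    walk⇒simplePath (step e walk) = prepend e (walk⇒simplePath walk)

  Avoiding : (C → C → Set) → C → C → C → C → Set
  Avoiding Adj u v x y = Adj x y × ¬ (x ≡ u × y ≡ v)

  closePath : ∀ {E Adj : C → C → Set} {u v z xs} →
    (∀ {x y} → E x y → Adj x y) → Path E u v xs → Adj v z → Linked Adj (u ∷ xs ++ z ∷ [])
  closePath f []         vz = vz ∷ [-]
  closePath f (e ∷ path) vz = f e ∷ closePath f path vz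

  detour⇒cycle : DecidableEquality C → ∀ {Vert : C → Set} {Adj : C → C → Set} {u v} →
    u ≢ v → Adj v u → Walk Vert (Avoiding Adj u v) u v → HasCycle Vert Adj
  detour⇒cycle _≟_ {u = u} u≢v vu walk with walk⇒simplePath _≟_ walk
  ... | _  , []                , _    = contradiction refl u≢v
  ... | _  , (_ , not-uv) ∷ [] , _    = contradiction (refl , refl) not-uv
  ... | xs , path@(_ ∷ _ ∷ _)  , uniq = u , xs , s≤s (s≤s z≤n) , uniq , closePath proj₁ path vu

covers⇒⊆ : ∀ {n} {𝒱 : Family n} {S T} → Covers 𝒱 S T → T ⊆ S
covers⇒⊆ (_ , _ , T⊂S , _) = p⊂q⇒p⊆q T⊂S

module _ {n : ℕ} {X : Subset n} {𝒱 : Family n} (V : RegularVine X 𝒱) where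
  open RegularVine V

  suc-∣covered∣ : ∀ {S T} → Covers 𝒱 S T → suc ∣ T ∣ ≡ ∣ S ∣
  suc-∣covered∣ {S} {T} S⊐T = trans (+-comm 1 ∣ T ∣) (graded S T S⊐T)

  ∣member∣≢0 : ∀ {T} → Mem 𝒱 T → ∣ T ∣ ≢ 0
  ∣member∣≢0 {T} T∈𝒱 ∣T∣≡0 with twoCovers T T∈𝒱 ¬minimal
    where
    ¬minimal : ¬ Minimal 𝒱 T
    ¬minimal T-minimal with minimal T T-minimal
    ... | x , _ , refl = contradiction (trans (sym (∣⁅x⁆∣≡1 x)) ∣T∣≡0) λ ()
  ... | _ , _ , _ , T⊐T₁ , _ = contradiction (trans (suc-∣covered∣ T⊐T₁) ∣T∣≡0) λ ()

module Subvine {n : ℕ} {X X′ : Subset n} {𝒱 𝒱′ : Family n}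
  (V : RegularVine X 𝒱) (V′ : RegularVine X′ 𝒱′) (𝒱′⊆𝒱 : ∀ S → Mem 𝒱′ S → Mem 𝒱 S) where
  private
    module V  = RegularVine V
    module V′ = RegularVine V′

  covers⁺ : ∀ {S T} → Covers 𝒱′ S T → Covers 𝒱 S T
  covers⁺ S⊐T@(T∈𝒱′ , S∈𝒱′ , T⊂S , _) = 𝒱′⊆𝒱 _ T∈𝒱′ , 𝒱′⊆𝒱 _ S∈𝒱′ , T⊂S ,
    λ _ _ T⊆U U⊆S → between-consecutive T⊆U U⊆S (V′.graded _ _ S⊐T)

  rank⁺ : ∀ {i T} → Rank 𝒱′ i T → Rank 𝒱 i T
  rank⁺ (T∈𝒱′ , ∣T∣≡i) = 𝒱′⊆𝒱 _ T∈𝒱′ , ∣T∣≡i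

  levelAdj⁺ : ∀ {i u v} → LevelAdj 𝒱′ i u v → LevelAdj 𝒱 i u v
  levelAdj⁺ (ru , rv , u≢v , S , rS , S⊐u , S⊐v) =
    rank⁺ ru , rank⁺ rv , u≢v , S , rank⁺ rS , covers⁺ S⊐u , covers⁺ S⊐v

  ¬¬common-cover-member : ∀ {j S T₁ T₂} → 1 ≤ j → j ≤ ∣ X ∣ ∸ 1 → j ≤ ∣ X′ ∣ ∸ 1 →
    T₁ ≢ T₂ → Rank 𝒱′ j T₁ → Rank 𝒱′ j T₂ → Rank 𝒱 (j + 1) S →
    Covers 𝒱 S T₁ → Covers 𝒱 S T₂ → ¬ ¬ Mem 𝒱′ S
  ¬¬common-cover-member {j} {S} {T₁} {T₂} 1≤j j≤∣X∣∸1 j≤∣X′∣∸1 T₁≢T₂ r₁ r₂ rS S⊐T₁ S⊐T₂ S∉𝒱′ =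
    proj₂ (proj₂ (V.tree j 1≤j j≤∣X∣∸1))
      (detour⇒cycle (≡-dec _≟ᵇ_) T₁≢T₂ T₂—T₁ (mapWalk avoids T₁⇝T₂))
    where
    T₁⇝T₂ : Walk (Rank 𝒱′ j) (LevelAdj 𝒱′ j) T₁ T₂
    T₁⇝T₂ = proj₁ (proj₂ (V′.tree j 1≤j j≤∣X′∣∸1)) T₁ T₂ r₁ r₂

    T₂—T₁ : LevelAdj 𝒱 j T₂ T₁
    T₂—T₁ = rank⁺ r₂ , rank⁺ r₁ , T₁≢T₂ ∘ sym , S , rS , S⊐T₂ , S⊐T₁

    T₁∪T₂≡ : ∀ {R} → ∣ R ∣ ≡ j + 1 → T₁ ⊆ R → T₂ ⊆ R → T₁ ∪ T₂ ≡ R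
    T₁∪T₂≡ ∣R∣≡j+1 = distinct-⊆-consecutive⇒∪≡ T₁≢T₂ (trans (proj₂ r₁) (sym (proj₂ r₂)))
      (trans (cong (_+ 1) (proj₂ r₁)) (sym ∣R∣≡j+1))

    avoids : ∀ {u v} → LevelAdj 𝒱′ j u v → Avoiding (LevelAdj 𝒱 j) T₁ T₂ u v
    avoids u—v@(_ , _ , _ , S′ , (S′∈𝒱′ , ∣S′∣≡j+1) , S′⊐u , S′⊐v) = levelAdj⁺ u—v ,
      λ { (refl , refl) → S∉𝒱′ (subst (Mem 𝒱′)
            (trans (sym (T₁∪T₂≡ ∣S′∣≡j+1 (covers⇒⊆ S′⊐u) (covers⇒⊆ S′⊐v)))
                   (T₁∪T₂≡ (proj₂ rS) (covers⇒⊆ S⊐T₁) (covers⇒⊆ S⊐T₂)))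
            S′∈𝒱′) }

  restriction-of-card : ∀ k {S} → ∣ S ∣ ≡ k → Mem 𝒱 S → S ⊆ X′ → Mem 𝒱′ S
  restriction-of-card zero    ∣S∣≡0   S∈𝒱 _ = contradiction ∣S∣≡0 (∣member∣≢0 V S∈𝒱)
  restriction-of-card (suc j) {S} ∣S∣≡1+j S∈𝒱 S⊆X′ = decidable-stable (𝒱′ S ≟ᵇ true) λ S∉𝒱′ →
    let T₁ , T₂ , T₁≢T₂ , S⊐T₁ , S⊐T₂ , _ = V.twoCovers S S∈𝒱 (¬minimal S∉𝒱′)
        r₁ = covered-rank S⊐T₁
    in ¬¬common-cover-member
         (n≢0⇒n>0 (λ j≡0 → ∣member∣≢0 V′ (proj₁ r₁) (trans (proj₂ r₁) j≡0)))
         (∣p∣≡1+j∧p⊆q⇒j≤∣q∣∸1 ∣S∣≡1+j (V.sub S S∈𝒱)) (∣p∣≡1+j∧p⊆q⇒j≤∣q∣∸1 ∣S∣≡1+j S⊆X′)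
         T₁≢T₂ r₁ (covered-rank S⊐T₂) (S∈𝒱 , trans ∣S∣≡1+j (+-comm 1 j)) S⊐T₁ S⊐T₂ S∉𝒱′
    where
    ¬minimal : ¬ Mem 𝒱′ S → ¬ Minimal 𝒱 S
    ¬minimal S∉𝒱′ S-minimal with V.minimal S S-minimal
    ... | x , _ , refl = S∉𝒱′ (V′.singleton x (S⊆X′ (x∈⁅x⁆ x)))

    covered-rank : ∀ {T} → Covers 𝒱 S T → Rank 𝒱′ j T
    covered-rank S⊐T = restriction-of-card j ∣T∣≡j (proj₁ S⊐T) (S⊆X′ ∘ covers⇒⊆ S⊐T) , ∣T∣≡j
      where
      ∣T∣≡j = suc-injective (trans (suc-∣covered∣ V S⊐T) ∣S∣≡1+j)

  restriction : ∀ {S} → Mem 𝒱 S → S ⊆ X′ → Mem 𝒱′ S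
  restriction = restriction-of-card _ refl

lemma2p12 : (n : ℕ) → 3 ≤ n → (a₁ a₂ : Fin n) → a₁ ≢ a₂ →
    (𝒱₁ 𝒱₂ 𝒱′ : Family n) →
    RegularVine (⊤ - a₁) 𝒱₁ → RegularVine (⊤ - a₂) 𝒱₂ →
    RegularVine (⊤ - a₁ - a₂) 𝒱′ →
    (∀ S → Mem 𝒱′ S → Mem 𝒱₁ S × Mem 𝒱₂ S) →
    ∀ S → Mem 𝒱′ S ⇔ (Mem 𝒱₁ S × Mem 𝒱₂ S)
lemma2p12 _ _ a₁ a₂ _ 𝒱₁ 𝒱₂ 𝒱′ V₁ V₂ V′ 𝒱′⊆𝒱₁∩𝒱₂ S =
  mk⇔ (𝒱′⊆𝒱₁∩𝒱₂ S) λ (S∈𝒱₁ , S∈𝒱₂) →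
    Subvine.restriction V₁ V′ (λ T → proj₁ ∘ 𝒱′⊆𝒱₁∩𝒱₂ T) S∈𝒱₁ (S⊆A-a₁-a₂ S∈𝒱₁ S∈𝒱₂)
  where
  S⊆A-a₁-a₂ : Mem 𝒱₁ S → Mem 𝒱₂ S → S ⊆ ⊤ - a₁ - a₂
  S⊆A-a₁-a₂ S∈𝒱₁ S∈𝒱₂ x∈S = x∈p∧x≢y⇒x∈p-y
    (RegularVine.sub V₁ S S∈𝒱₁ x∈S) (x∈p-y⇒x≢y (RegularVine.sub V₂ S S∈𝒱₂ x∈S))
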